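{- Consider a data structure consisting of a finite set of nodes, each node $x$ having a distinct key (from a totally ordered set), a membership vector $m(x)\in\Sigma^\omega$, and, for every level $\ell\ge 0$, a right pointer $xR_\ell$ and a left pointer $xL_\ell$, each equal either to a node or to $\bot$. Then every connected component of the data structure is a skip graph if and only if, for every node $x$ and every level $\ell \ge 0$, the following six constraints hold: (1) if $xR_\ell \ne \bot$ then $xR_\ell > x$; (2) if $xL_\ell \ne \bot$ then $xL_\ell < x$; (3) if $xR_\ell \ne \bot$ then $xR_\ell L_\ell = x$; (4) if $xL_\ell \ne \bot$ then $xL_\ell R_\ell = x$; (5) if there is $k\ge 1$ with $xR_\ell^k\neq\bot$, $m(x)\upharpoonright(\ell+1) = m(xR_\ell^k)\upharpoonright(\ell+1)$, and no $j$ with $1\le j<k$ satisfies $m(x)\upharpoonright(\ell+1) = m(xR_\ell^j)\upharpoonright(\ell+1)$, then $xR_{\ell+1} = xR_\ell^k$; otherwise $xR_{\ell+1} = \bot$; (6) if there is $k\ge 1$ with $xL_\ell^k\neq\bot$, $m(x)\upharpoonright(\ell+1) = m(xL_\ell^k)\upharpoonright(\ell+1)$, and no $j$ with $1\le j<k$ satisfies $m(x)\upharpoonright(\ell+1) = m(xL_\ell^j)\upharpoonright(\ell+1)$, then $xL_{\ell+1} = xL_\ell^k$; otherwise $xL_{\ell+1} = \bot$.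
   Context: $\Sigma$ is a finite alphabet, $w\upharpoonright i$ is the length-$i$ prefix of a word $w$. Nodes are compared by their keys. Pointer expressions compose left to right: $xR_\ell L_\ell$ is the left level-$\ell$ pointer of the node $xR_\ell$, and $xR_\ell^k$ is the result of following the right level-$\ell$ pointer $k$ times (any expression passing through $\bot$ is $\bot$). The connected components are those of the undirected graph on the nodes with an edge between $x$ and $y$ whenever $y = xR_\ell$ or $y = xL_\ell$ for some $\ell$. A set $C$ of nodes (with its pointers) is a skip graph if for every $x\in C$ and every $\ell\ge 0$, $xR_\ell$ is the immediate successor of $x$ (by key) in the list of all nodes $y\in C$ with $m(y)\upharpoonright\ell = m(x)\upharpoonright\ell$, or $\bot$ if there is none, and $xL_\ell$ is likewise the immediate predecessor of $x$ in that list, or $\bot$ if there is none. -}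

module Defs where

open import Level using (Level; _⊔_)
open import Data.Nat using (ℕ; zero; suc; _<_; _≤_)
open import Data.Fin using (Fin)
open import Data.Maybe using (Maybe; just; nothing)
open import Data.Product using (_×_; ∃; ∃-syntax; Σ-syntax)
open import Relation.Nullary using (¬_)
open import Relation.Binary.PropositionalEquality using (_≡_)
open import Relation.Binary.Bundles using (StrictTotalOrder)

-- The data structure: nodes are Fin n, keys come from a strict total order K,
-- membership vectors are infinite words ℕ → Fin s over the finite alphabet Fin s,
-- pointers R ℓ x / L ℓ x are 'Maybe (Fin n)' with 'nothing' playing the role of ⊥.
module SkipGraph {a ℓ₁ ℓ₂ : Level} (K : StrictTotalOrder a ℓ₁ ℓ₂)
                 {s n : ℕ}
                 (key : Fin n → StrictTotalOrder.Carrier K)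
                 (m : Fin n → ℕ → Fin s)
                 (R L : ℕ → Fin n → Maybe (Fin n)) where

  open StrictTotalOrder K using () renaming (_≈_ to _≈ₖ_; _<_ to _<ₖ_)

  Node : Set
  Node = Fin n

  DistinctKeys : Set ℓ₁
  DistinctKeys = ∀ x y → key x ≈ₖ key y → x ≡ y

  PrefixEq : ℕ → Node → Node → Set
  PrefixEq i x y = ∀ j → j < i → m x j ≡ m y j

  _>>=′_ : Maybe Node → (Node → Maybe Node) → Maybe Node
  just x >>=′ f = f x
  nothing >>=′ f = nothing

  Rpow : ℕ → ℕ → Node → Maybe Node
  Rpow ℓ zero    x = just x
  Rpow ℓ (suc k) x = Rpow ℓ k x >>=′ R ℓ

  Lpow : ℕ → ℕ → Node → Maybe Node
  Lpow ℓ zero    x = just x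
  Lpow ℓ (suc k) x = Lpow ℓ k x >>=′ L ℓ

  data Edge (x y : Node) : Set where
    viaR  : ∀ ℓ → R ℓ x ≡ just y → Edge x y
    viaL  : ∀ ℓ → L ℓ x ≡ just y → Edge x y
    viaR⁻ : ∀ ℓ → R ℓ y ≡ just x → Edge x y
    viaL⁻ : ∀ ℓ → L ℓ y ≡ just x → Edge x y

  data Connected (x : Node) : Node → Set where
    here : Connected x x
    step : ∀ {y z} → Connected x y → Edge y z → Connected x z

  ImmSucc : (Node → Set) → ℕ → Node → Maybe Node → Set (ℓ₂)
  ImmSucc C ℓ x (just y) =
    C y × PrefixEq ℓ x y × key x <ₖ key y ×
    (∀ z → C z → PrefixEq ℓ x z → key x <ₖ key z → ¬ (key z <ₖ key y))
  ImmSucc C ℓ x nothing =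
    ∀ z → C z → PrefixEq ℓ x z → ¬ (key x <ₖ key z)

  ImmPred : (Node → Set) → ℕ → Node → Maybe Node → Set (ℓ₂)
  ImmPred C ℓ x (just y) =
    C y × PrefixEq ℓ x y × key y <ₖ key x ×
    (∀ z → C z → PrefixEq ℓ x z → key z <ₖ key x → ¬ (key y <ₖ key z))
  ImmPred C ℓ x nothing =
    ∀ z → C z → PrefixEq ℓ x z → ¬ (key z <ₖ key x)

  IsSkipGraph : (Node → Set) → Set ℓ₂
  IsSkipGraph C = ∀ x → C x → ∀ ℓ → ImmSucc C ℓ x (R ℓ x) × ImmPred C ℓ x (L ℓ x)

  AllComponentsSkipGraphs : Set ℓ₂
  AllComponentsSkipGraphs = ∀ x → IsSkipGraph (Connected x)

  C1 C2 C3 C4 : Node → ℕ → Set ℓ₂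
  C1 x ℓ = ∀ y → R ℓ x ≡ just y → key x <ₖ key y
  C2 x ℓ = ∀ y → L ℓ x ≡ just y → key y <ₖ key x
  C3 x ℓ = ∀ y → R ℓ x ≡ just y → Lift′ (L ℓ y ≡ just x)
    where Lift′ = Level.Lift ℓ₂
  C4 x ℓ = ∀ y → L ℓ x ≡ just y → Lift′ (R ℓ y ≡ just x)
    where Lift′ = Level.Lift ℓ₂

  FirstMatch : (ℕ → ℕ → Node → Maybe Node) → ℕ → Node → ℕ → Node → Set
  FirstMatch Pow ℓ x k y =
    1 ≤ k × Pow ℓ k x ≡ just y × PrefixEq (suc ℓ) x y ×
    (∀ j z → 1 ≤ j → j < k → Pow ℓ j x ≡ just z → ¬ PrefixEq (suc ℓ) x z)

  C5 C6 : Node → ℕ → Set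
  C5 x ℓ = (∀ k y → FirstMatch Rpow ℓ x k y → R (suc ℓ) x ≡ just y)
         × (¬ (∃[ k ] ∃[ y ] FirstMatch Rpow ℓ x k y) → R (suc ℓ) x ≡ nothing)
  C6 x ℓ = (∀ k y → FirstMatch Lpow ℓ x k y → L (suc ℓ) x ≡ just y)
         × (¬ (∃[ k ] ∃[ y ] FirstMatch Lpow ℓ x k y) → L (suc ℓ) x ≡ nothing)

  LocalConstraints : Set ℓ₂
  LocalConstraints = ∀ x ℓ →
    C1 x ℓ × C2 x ℓ × C3 x ℓ × C4 x ℓ × Level.Lift ℓ₂ (C5 x ℓ × C6 x ℓ)

{-# OPTIONS --safe #-}
-- It suffices to treat the right pointers: the left pointers are the right pointers of the
-- same structure with the key order reversed and R, L swapped.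
--
-- (⇒) In a component, R ℓ x is the least node above x sharing its ℓ-prefix. By induction
-- along the (finite, hence well-founded) order, every such node is reached from x by a
-- level-ℓ walk; so R (ℓ+1) x is the first node of that walk with the right (ℓ+1)-prefix,
-- which is (5), while (1) and (3) follow from the minimality of successors and predecessors.
--
-- (⇐) By (5) every pointer descends to a level-0 walk, so connected nodes lie on one
-- level-0 list (walks into a common node are compared by walking back along L₀ = R₀⁻¹).
-- If x < z share the ℓ-prefix, the level-0 walk from x to z is lifted level by level to a
-- level-ℓ walk, so no such z lies strictly between x and R ℓ x. As (5) pins down ⊥ only
-- negatively, this is argued under double negation; the conclusions that need it are
-- negative, or decidable like prefix equality.
module Submission where

open import Defs
open import Level using (Level; 0ℓ; lift; lower)
open import Function using (flip; _∘_; case_of_)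
open import Function.Bundles using (_⇔_; mk⇔)
open import Data.Nat using (ℕ; zero; suc; _+_; _∸_; _<_; _≤_; z≤n; s≤s)
open import Data.Nat.Properties using (≤-refl; ≤-total; <-cmp; m∸n+n≡m; m<n⇒m<1+n; m<1+n⇒m<n∨m≡n; allUpTo?)
open import Data.Fin using (Fin)
open import Data.Fin.Properties using (_≟_)
open import Data.Fin.Induction using (spo-noetherian)
import Data.Maybe as Maybe
open import Data.Maybe using (Maybe; just; nothing)
open import Data.Product using (_×_; _,_; proj₁; proj₂; ∃-syntax)
import Data.Sum as Sum
open import Data.Sum using (_⊎_; inj₁; inj₂)
open import Data.Empty using (⊥-elim)
open import Relation.Binary.Core using (Rel)
open import Relation.Binary.Bundles using (StrictTotalOrder)
open import Relation.Binary.Definitions using (Transitive; Trichotomous; tri<; tri≈; tri>)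
open import Relation.Binary.PropositionalEquality using (_≡_; refl; sym; trans; cong; subst; module ≡-Reasoning)
import Relation.Binary.Construct.On as On
import Relation.Binary.Construct.Flip.EqAndOrd as Flip
open import Induction.WellFounded using (WellFounded; Acc; acc)
open import Relation.Nullary using (¬_; Dec; yes; no)
open import Relation.Nullary.Decidable using (map′; decidable-stable)
open import Relation.Nullary.Negation using (¬¬-Monad; ¬¬-map)
open import Effect.Monad using (RawMonad)

-- Walks along a partial function

iterate : ∀ {a} {A : Set a} → (A → Maybe A) → ℕ → A → Maybe A
iterate f zero    x = just x
iterate f (suc k) x = iterate f k x Maybe.>>= f

Reach : ∀ {a} {A : Set a} → (A → Maybe A) → A → A → Set a
Reach f x y = ∃[ k ] iterate f k x ≡ just y

module _ {a} {A : Set a} {f : A → Maybe A} where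

  iterate-suc : ∀ k {x u w} → iterate f k x ≡ just u → f u ≡ just w → iterate f (suc k) x ≡ just w
  iterate-suc k eu uw = trans (cong (Maybe._>>= f) eu) uw

  iterate-suc⁻¹ : ∀ k {x w} → iterate f (suc k) x ≡ just w → ∃[ u ] iterate f k x ≡ just u × f u ≡ just w
  iterate-suc⁻¹ k {x} e with iterate f k x
  ... | just u = u , refl , e

  iterate-front⁻¹ : ∀ k {x z} → iterate f (suc k) x ≡ just z → ∃[ w ] f x ≡ just w × iterate f k w ≡ just z
  iterate-front⁻¹ zero    e = _ , e , refl
  iterate-front⁻¹ (suc k) e with iterate-suc⁻¹ (suc k) e
  ... | u , eu , uz with iterate-front⁻¹ k eu
  ...   | w , xw , wu = w , xw , iterate-suc k wu uz

  iterate-+ : ∀ i {j x y} → iterate f j x ≡ just y → iterate f (i + j) x ≡ iterate f i y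
  iterate-+ zero    e = e
  iterate-+ (suc i) e = cong (Maybe._>>= f) (iterate-+ i e)

  reach-refl : ∀ {x} → Reach f x x
  reach-refl = 0 , refl

  reach-step : ∀ {x y} → f x ≡ just y → Reach f x y
  reach-step e = 1 , e

  reach-trans : ∀ {x y z} → Reach f x y → Reach f y z → Reach f x z
  reach-trans (j , xy) (i , yz) = i + j , trans (iterate-+ i xy) yz

  reach-front : ∀ {x z} → Reach f x z → x ≡ z ⊎ ∃[ w ] f x ≡ just w × Reach f w z
  reach-front (zero  , refl) = inj₁ refl
  reach-front (suc k , e) with iterate-front⁻¹ k e
  ... | w , xw , wz = inj₂ (w , xw , k , wz)

  module _ {p} (P : A → Set p) (P-step : ∀ {u v} → f u ≡ just v → P u → P v) where

    iterate-invariant : ∀ k {x y} → iterate f k x ≡ just y → P x → P y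
    iterate-invariant zero    refl px = px
    iterate-invariant (suc k) e    px with iterate-suc⁻¹ k e
    ... | u , eu , uy = P-step uy (iterate-invariant k eu px)

    reach-invariant : ∀ {x y} → Reach f x y → P x → P y
    reach-invariant (k , e) = iterate-invariant k e

  iterate-∸ : ∀ {i j x y z} → i ≤ j → iterate f i x ≡ just y → iterate f j x ≡ just z →
              iterate f (j ∸ i) y ≡ just z
  iterate-∸ {i} {j} {x} {y} {z} i≤j xy xz = begin
    iterate f (j ∸ i) y      ≡⟨ iterate-+ (j ∸ i) xy ⟨
    iterate f (j ∸ i + i) x  ≡⟨ cong (λ t → iterate f t x) (m∸n+n≡m i≤j) ⟩
    iterate f j x            ≡⟨ xz ⟩
    just z                   ∎
    where open ≡-Reasoning

  reach-total : ∀ {x y z} → Reach f x y → Reach f x z → Reach f y z ⊎ Reach f z y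
  reach-total (i , xy) (j , xz) with ≤-total i j
  ... | inj₁ i≤j = inj₁ (j ∸ i , iterate-∸ i≤j xy xz)
  ... | inj₂ j≤i = inj₂ (i ∸ j , iterate-∸ j≤i xz xy)

module _ {a} {A : Set a} {f g : A → Maybe A} where

  reach-inverse : (∀ {u v} → f u ≡ just v → g v ≡ just u) → ∀ {x y} → Reach f x y → Reach g y x
  reach-inverse inverse {x} r =
    reach-invariant (λ v → Reach g v x) (λ uv vx → reach-trans (reach-step (inverse uv)) vx) r reach-refl

  reach-¬¬-simulate : (∀ {u v} → f u ≡ just v → ¬ ¬ Reach g u v) → ∀ {x y} → Reach f x y → ¬ ¬ Reach g x y
  reach-¬¬-simulate simulate {x} r = reach-invariant (λ v → ¬ ¬ Reach g x v) extend r (pure reach-refl)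
    where
    open RawMonad (¬¬-Monad {a}) using (_>>=_; pure)
    extend : ∀ {u v} → f u ≡ just v → ¬ ¬ Reach g x u → ¬ ¬ Reach g x v
    extend uv ¬¬xu = do
      xu ← ¬¬xu
      uv′ ← simulate uv
      pure (reach-trans xu uv′)

module _ {a r} {A : Set a} {_≺_ : Rel A r} (≺-trans : Transitive _≺_)
         {f : A → Maybe A} (f-increasing : ∀ {x y} → f x ≡ just y → x ≺ y) where

  iterate-monotone : ∀ {i j x y z} → i < j → iterate f i x ≡ just y → iterate f j x ≡ just z → y ≺ z
  iterate-monotone {i} {suc j} i<1+j xy xz with iterate-suc⁻¹ j xz | m<1+n⇒m<n∨m≡n i<1+j
  ... | u , xu , uz | inj₁ i<j  = ≺-trans (iterate-monotone i<j xy xu) (f-increasing uz)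
  ... | u , xu , uz | inj₂ refl with trans (sym xy) xu
  ...   | refl = f-increasing uz

  reach-increasing : ∀ {x y} → Reach f x y → x ≡ y ⊎ x ≺ y
  reach-increasing (zero  , refl) = inj₁ refl
  reach-increasing (suc k , e)    = inj₂ (iterate-monotone {j = suc k} (s≤s z≤n) refl e)

  iterate-reflects-< : (∀ {x} → ¬ x ≺ x) → ∀ {i j x y z} →
                       iterate f i x ≡ just y → iterate f j x ≡ just z → y ≺ z → i < j
  iterate-reflects-< irrefl {i} {j} xy xz y≺z with <-cmp i j
  ... | tri< i<j _ _ = i<j
  ... | tri≈ _ refl _ with trans (sym xy) xz
  ...   | refl = ⊥-elim (irrefl y≺z)
  iterate-reflects-< irrefl {i} {j} xy xz y≺z | tri> _ _ j<i =
    ⊥-elim (irrefl (≺-trans y≺z (iterate-monotone j<i xz xy)))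

-- The right pointers

module RightPointers {a ℓ₁ ℓ₂ : Level} (K : StrictTotalOrder a ℓ₁ ℓ₂) {s n : ℕ}
  (key : Fin n → StrictTotalOrder.Carrier K) (m : Fin n → ℕ → Fin s)
  (R L : ℕ → Fin n → Maybe (Fin n))
  (distinct : SkipGraph.DistinctKeys K key m R L) where

  open SkipGraph K key m R L
  open StrictTotalOrder K using (compare; isStrictPartialOrder; module Eq)
    renaming (_<_ to _<ₖ_; trans to <ₖ-trans; irrefl to <ₖ-irrefl; asym to <ₖ-asym)

  _≺_ : Node → Node → Set ℓ₂
  x ≺ y = key x <ₖ key y

  ≺-trans : Transitive _≺_
  ≺-trans = <ₖ-trans

  ≺-irrefl : ∀ {x} → ¬ x ≺ x
  ≺-irrefl = <ₖ-irrefl Eq.refl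

  ≺-asym : ∀ {x y} → x ≺ y → ¬ y ≺ x
  ≺-asym = <ₖ-asym

  ≺-compare : Trichotomous _≡_ _≺_
  ≺-compare x y with compare (key x) (key y)
  ... | tri< lt ¬eq ¬gt = tri< lt (¬eq ∘ Eq.reflexive ∘ cong key) ¬gt
  ... | tri≈ ¬lt eq ¬gt = tri≈ ¬lt (distinct x y eq) ¬gt
  ... | tri> ¬lt ¬eq gt = tri> ¬lt (¬eq ∘ Eq.reflexive ∘ cong key) gt

  ≺-noetherian : WellFounded (flip _≺_)
  ≺-noetherian = spo-noetherian (On.isStrictPartialOrder key isStrictPartialOrder)

  PrefixEq-sym : ∀ {i x y} → PrefixEq i x y → PrefixEq i y x
  PrefixEq-sym p j j<i = sym (p j j<i)

  PrefixEq-trans : ∀ {i x y z} → PrefixEq i x y → PrefixEq i y z → PrefixEq i x z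
  PrefixEq-trans p q j j<i = trans (p j j<i) (q j j<i)

  PrefixEq-weaken : ∀ {i x y} → PrefixEq (suc i) x y → PrefixEq i x y
  PrefixEq-weaken p j j<i = p j (m<n⇒m<1+n j<i)

  PrefixEq? : ∀ i x y → Dec (PrefixEq i x y)
  PrefixEq? i x y = map′ (λ p j j<i → p j<i) (λ p {j} → p j) (allUpTo? (λ j → m x j ≟ m y j) i)

  FollowsFirstMatch : (ℕ → ℕ → Node → Maybe Node) → (ℕ → Node → Maybe Node) → Node → ℕ → Set
  FollowsFirstMatch Pow P x ℓ =
    (∀ k y → FirstMatch Pow ℓ x k y → P (suc ℓ) x ≡ just y) ×
    (¬ (∃[ k ] ∃[ y ] FirstMatch Pow ℓ x k y) → P (suc ℓ) x ≡ nothing)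

  FirstMatch-cong : ∀ {Pow Pow′ ℓ x k y} → (∀ ℓ k x → Pow ℓ k x ≡ Pow′ ℓ k x) →
                    FirstMatch Pow ℓ x k y → FirstMatch Pow′ ℓ x k y
  FirstMatch-cong Pow≗Pow′ (0<k , e , xy , unmatched) =
    0<k , trans (sym (Pow≗Pow′ _ _ _)) e , xy ,
    λ j z 0<j j<k e′ → unmatched j z 0<j j<k (trans (Pow≗Pow′ _ _ _) e′)

  FollowsFirstMatch-cong : ∀ {Pow Pow′ P x ℓ} → (∀ ℓ k x → Pow ℓ k x ≡ Pow′ ℓ k x) →
                           FollowsFirstMatch Pow P x ℓ → FollowsFirstMatch Pow′ P x ℓ
  FollowsFirstMatch-cong Pow≗Pow′ (first-match , unmatched) =
    (λ k y → first-match k y ∘ FirstMatch-cong (λ ℓ k x → sym (Pow≗Pow′ ℓ k x))) ,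
    (λ none → unmatched λ (k , y , fm) → none (k , y , FirstMatch-cong Pow≗Pow′ fm))

  Riter : ℕ → ℕ → Node → Maybe Node
  Riter ℓ = iterate (R ℓ)

  module IncreasingWalks (R-increasing : ∀ {ℓ x y} → R ℓ x ≡ just y → x ≺ y) where

    Riter-monotone : ∀ {ℓ i j x y z} → i < j → Riter ℓ i x ≡ just y → Riter ℓ j x ≡ just z → y ≺ z
    Riter-monotone = iterate-monotone ≺-trans R-increasing

    Riter-reflects-< : ∀ {ℓ i j x y z} → Riter ℓ i x ≡ just y → Riter ℓ j x ≡ just z → y ≺ z → i < j
    Riter-reflects-< = iterate-reflects-< ≺-trans R-increasing ≺-irrefl

    R-reach-increasing : ∀ {ℓ x y} → Reach (R ℓ) x y → x ≡ y ⊎ x ≺ y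
    R-reach-increasing = reach-increasing ≺-trans R-increasing

  module FromSkipGraphs (skipGraphs : AllComponentsSkipGraphs) where

    succ-just : ∀ {x₀ x y ℓ} → Connected x₀ x → R ℓ x ≡ just y → ImmSucc (Connected x₀) ℓ x (just y)
    succ-just c e = subst (ImmSucc _ _ _) e (proj₁ (skipGraphs _ _ c _))

    succ-nothing : ∀ {x₀ x ℓ} → Connected x₀ x → R ℓ x ≡ nothing → ImmSucc (Connected x₀) ℓ x nothing
    succ-nothing c e = subst (ImmSucc _ _ _) e (proj₁ (skipGraphs _ _ c _))

    pred-just : ∀ {x₀ x y ℓ} → Connected x₀ x → L ℓ x ≡ just y → ImmPred (Connected x₀) ℓ x (just y)
    pred-just c e = subst (ImmPred _ _ _) e (proj₂ (skipGraphs _ _ c _))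

    pred-nothing : ∀ {x₀ x ℓ} → Connected x₀ x → L ℓ x ≡ nothing → ImmPred (Connected x₀) ℓ x nothing
    pred-nothing c e = subst (ImmPred _ _ _) e (proj₂ (skipGraphs _ _ c _))

    R-increasing : ∀ {ℓ x y} → R ℓ x ≡ just y → x ≺ y
    R-increasing e = let (_ , _ , x≺y , _) = succ-just here e in x≺y

    R⇒L : ∀ {ℓ x y} → R ℓ x ≡ just y → L ℓ y ≡ just x
    R⇒L {ℓ} {x} {y} e with succ-just here e | L ℓ y in e′
    ... | _ , xy , x≺y , _ | nothing =
      ⊥-elim (pred-nothing (step here (viaR ℓ e)) e′ x here (PrefixEq-sym xy) x≺y)
    ... | _ , xy , x≺y , nothing-between | just w
      with pred-just (step here (viaR ℓ e)) e′
    ...   | cw , yw , w≺y , nothing-between′ with ≺-compare w x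
    ...     | tri< w≺x _ _ = ⊥-elim (nothing-between′ x here (PrefixEq-sym xy) x≺y w≺x)
    ...     | tri≈ _ refl _ = refl
    ...     | tri> _ _ x≺w = ⊥-elim (nothing-between w cw (PrefixEq-trans xy yw) x≺w w≺y)

    open IncreasingWalks R-increasing

    walk-connected : ∀ {ℓ x₀ x y} → Reach (R ℓ) x y → Connected x₀ x → Connected x₀ y
    walk-connected {ℓ} {x₀} = reach-invariant (Connected x₀) (λ e c → step c (viaR ℓ e))

    R-least : ∀ {ℓ x₀ x z} → Connected x₀ x → Connected x₀ z → PrefixEq ℓ x z → x ≺ z →
              ∃[ y ] R ℓ x ≡ just y × (y ≡ z ⊎ y ≺ z)
    R-least {ℓ} {x = x} {z} cx cz xz x≺z with R ℓ x in e
    ... | nothing = ⊥-elim (succ-nothing cx e z cz xz x≺z)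
    ... | just y with succ-just cx e | ≺-compare y z
    ...   | _ , _ , _ , _ | tri< y≺z _ _ = y , refl , inj₂ y≺z
    ...   | _ , _ , _ , _ | tri≈ _ y≡z _ = y , refl , inj₁ y≡z
    ...   | _ , _ , _ , nothing-between | tri> _ _ z≺y = ⊥-elim (nothing-between z cz xz x≺z z≺y)

    -- Induction along ≻, which is well-founded because there are finitely many nodes.
    reach-component : ∀ {ℓ x₀ x z} → Acc (flip _≺_) x → Connected x₀ x → Connected x₀ z →
                      PrefixEq ℓ x z → x ≺ z → Reach (R ℓ) x z
    reach-component (acc above) cx cz xz x≺z with R-least cx cz xz x≺z
    ... | w , e , inj₁ refl = reach-step e
    ... | w , e , inj₂ w≺z with succ-just cx e
    ...   | cw , xw , x≺w , _ = reach-trans (reach-step e)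
      (reach-component (above x≺w) cw cz (PrefixEq-trans (PrefixEq-sym xw) xz) w≺z)

    followsFirstMatch : ∀ x ℓ → FollowsFirstMatch Riter R x ℓ
    followsFirstMatch x ℓ = first-match , no-match
      where
      walk-from-x : ∀ {z} → Connected x z → PrefixEq ℓ x z → x ≺ z → ∃[ k ] Riter ℓ k x ≡ just z × 0 < k
      walk-from-x cz xz x≺z = let (k , e) = reach-component (≺-noetherian x) here cz xz x≺z in
        k , e , Riter-reflects-< refl e x≺z

      first-match : ∀ k y → FirstMatch Riter ℓ x k y → R (suc ℓ) x ≡ just y
      first-match k y (0<k , e , xy , unmatched)
        with R-least here (walk-connected (k , e) here) xy (Riter-monotone 0<k refl e)
      ... | y′ , e′ , inj₁ refl = e′
      ... | y′ , e′ , inj₂ y′≺y with succ-just here e′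
      ...   | cy′ , xy′ , x≺y′ , _ = let (j , e″ , 0<j) = walk-from-x cy′ (PrefixEq-weaken xy′) x≺y′ in
        ⊥-elim (unmatched j y′ 0<j (Riter-reflects-< e″ e y′≺y) e″ xy′)

      no-match : ¬ (∃[ k ] ∃[ y ] FirstMatch Riter ℓ x k y) → R (suc ℓ) x ≡ nothing
      no-match none with R (suc ℓ) x in e′
      ... | nothing = refl
      ... | just y with succ-just here e′
      ...   | cy , xy , x≺y , nothing-between =
        let (k , e , 0<k) = walk-from-x cy (PrefixEq-weaken xy) x≺y in
        ⊥-elim (none (k , y , 0<k , e , xy , λ j z 0<j j<k ez xz →
          nothing-between z (walk-connected (j , ez) here) xz (Riter-monotone 0<j refl ez) (Riter-monotone j<k ez e)))

  module FromConstraints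
    (R-increasing : ∀ {ℓ x y} → R ℓ x ≡ just y → x ≺ y)
    (R⇒L : ∀ {ℓ x y} → R ℓ x ≡ just y → L ℓ y ≡ just x)
    (L⇒R : ∀ {ℓ x y} → L ℓ x ≡ just y → R ℓ y ≡ just x)
    (followsFirstMatch : ∀ x ℓ → FollowsFirstMatch Riter R x ℓ) where

    open IncreasingWalks R-increasing
    open RawMonad (¬¬-Monad {0ℓ}) using (_>>=_; pure)

    -- Constraint (5) determines R (suc ℓ) x = ⊥ only through a negated hypothesis, so the
    -- first match behind a pointer is recovered only up to double negation.
    firstMatch-of : ∀ {ℓ x y} → R (suc ℓ) x ≡ just y → ¬ ¬ (∃[ k ] FirstMatch Riter ℓ x k y)
    firstMatch-of {ℓ} {x} {y} e ¬first = case trans (sym e) (unmatched no-first) of λ ()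
      where
      first-match = proj₁ (followsFirstMatch x ℓ)
      unmatched = proj₂ (followsFirstMatch x ℓ)
      no-first : ¬ (∃[ k ] ∃[ y′ ] FirstMatch Riter ℓ x k y′)
      no-first (k , y′ , fm) with trans (sym e) (first-match k y′ fm)
      ... | refl = ¬first (k , fm)

    R-prefix : ∀ {ℓ x y} → R ℓ x ≡ just y → PrefixEq ℓ x y
    R-prefix {zero}  e = λ _ ()
    R-prefix {suc ℓ} e = decidable-stable (PrefixEq? _ _ _) (¬¬-map (λ (_ , _ , _ , xy , _) → xy) (firstMatch-of e))

    R-descend : ∀ {ℓ x y} → R ℓ x ≡ just y → ¬ ¬ Reach (R 0) x y
    R-descend {zero}  e = pure (reach-step e)
    R-descend {suc ℓ} e = do
      (k , _ , walk , _) ← firstMatch-of e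
      reach-¬¬-simulate R-descend (k , walk)

    _∼₀_ : Node → Node → Set
    x ∼₀ y = Reach (R 0) x y ⊎ Reach (R 0) y x

    ∼₀-sym : ∀ {x y} → x ∼₀ y → y ∼₀ x
    ∼₀-sym (inj₁ xy) = inj₂ xy
    ∼₀-sym (inj₂ yx) = inj₁ yx

    -- Two walks into the same node are compared by walking back along L₀.
    ∼₀-trans : ∀ {x y z} → x ∼₀ y → y ∼₀ z → x ∼₀ z
    ∼₀-trans (inj₁ xy) (inj₁ yz) = inj₁ (reach-trans xy yz)
    ∼₀-trans (inj₂ yx) (inj₂ zy) = inj₂ (reach-trans zy yx)
    ∼₀-trans (inj₂ yx) (inj₁ yz) = reach-total yx yz
    ∼₀-trans (inj₁ xy) (inj₂ zy) =
      ∼₀-sym (Sum.map (reach-inverse L⇒R) (reach-inverse L⇒R) (reach-total (reach-inverse R⇒L xy) (reach-inverse R⇒L zy)))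

    edge-∼₀ : ∀ {x y} → Edge x y → ¬ ¬ (x ∼₀ y)
    edge-∼₀ (viaR  _ e) = ¬¬-map inj₁ (R-descend e)
    edge-∼₀ (viaL  _ e) = ¬¬-map inj₂ (R-descend (L⇒R e))
    edge-∼₀ (viaR⁻ _ e) = ¬¬-map inj₂ (R-descend e)
    edge-∼₀ (viaL⁻ _ e) = ¬¬-map inj₁ (R-descend (L⇒R e))

    connected-∼₀ : ∀ {x y} → Connected x y → ¬ ¬ (x ∼₀ y)
    connected-∼₀ here       = pure (inj₁ reach-refl)
    connected-∼₀ (step c e) = do
      xy ← connected-∼₀ c
      yz ← edge-∼₀ e
      pure (∼₀-trans xy yz)

    ∼₀-reach : ∀ {x y} → x ∼₀ y → x ≺ y → Reach (R 0) x y
    ∼₀-reach (inj₁ xy) _ = xy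
    ∼₀-reach (inj₂ yx) x≺y with R-reach-increasing yx
    ... | inj₁ refl = ⊥-elim (≺-irrefl x≺y)
    ... | inj₂ y≺x  = ⊥-elim (≺-asym x≺y y≺x)

    Unmatched : ℕ → Node → ℕ → Set
    Unmatched ℓ x i = ∀ j z → 1 ≤ j → j < i → Riter ℓ j x ≡ just z → ¬ PrefixEq (suc ℓ) x z

    unmatched-1 : ∀ {ℓ x} → Unmatched ℓ x 1
    unmatched-1 _ _ (s≤s _) (s≤s ())

    unmatched-suc : ∀ {ℓ x i w} → Unmatched ℓ x (suc i) → Riter ℓ (suc i) x ≡ just w →
                    ¬ PrefixEq (suc ℓ) x w → Unmatched ℓ x (suc (suc i))
    unmatched-suc unmatched xw ¬xw j z 1≤j j<2+i xz with m<1+n⇒m<n∨m≡n j<2+i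
    ... | inj₁ j<1+i = unmatched j z 1≤j j<1+i xz
    ... | inj₂ refl with trans (sym xw) xz
    ...   | refl = ¬xw

    -- Follow the level-ℓ walk from x, now at its i-th node u: by constraint (5) the first node
    -- met that shares the (ℓ+1)-prefix of x is the level-(ℓ+1) successor of x.
    scan : ∀ {ℓ} k i {x u z} → Riter ℓ i x ≡ just u → Unmatched ℓ x (suc i) →
           Riter ℓ k u ≡ just z → PrefixEq (suc ℓ) x z → Reach (R (suc ℓ)) x z
    scan zero    zero    refl _         refl _  = reach-refl
    scan zero    (suc i) xu   unmatched refl xz = ⊥-elim (unmatched (suc i) _ (s≤s z≤n) ≤-refl xu xz)
    scan {ℓ} (suc k) i {x} xu unmatched uz xz with iterate-front⁻¹ k uz
    ... | w , uw , wz with iterate-suc i xu uw | PrefixEq? (suc ℓ) x w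
    ...   | xw | yes x∼w = reach-trans
      (reach-step (proj₁ (followsFirstMatch x ℓ) (suc i) w (s≤s z≤n , xw , x∼w , unmatched)))
      (scan k 0 refl unmatched-1 wz (PrefixEq-trans (PrefixEq-sym x∼w) xz))
    ...   | xw | no ¬x∼w = scan k (suc i) xw (unmatched-suc unmatched xw ¬x∼w) wz xz

    climb : ∀ {ℓ x z} → Reach (R ℓ) x z → PrefixEq (suc ℓ) x z → Reach (R (suc ℓ)) x z
    climb (k , xz) = scan k 0 refl unmatched-1 xz

    ∼₀-reach-level : ∀ ℓ {x y} → x ∼₀ y → PrefixEq ℓ x y → x ≺ y → Reach (R ℓ) x y
    ∼₀-reach-level zero    x∼y _  x≺y = ∼₀-reach x∼y x≺y
    ∼₀-reach-level (suc ℓ) x∼y xy x≺y = climb (∼₀-reach-level ℓ x∼y (PrefixEq-weaken xy) x≺y) xy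

    component-reach : ∀ {ℓ x₀ x z} → Connected x₀ x → Connected x₀ z → PrefixEq ℓ x z → x ≺ z →
                      ¬ ¬ Reach (R ℓ) x z
    component-reach {ℓ} cx cz xz x≺z = do
      x₀∼x ← connected-∼₀ cx
      x₀∼z ← connected-∼₀ cz
      pure (∼₀-reach-level ℓ (∼₀-trans (∼₀-sym x₀∼x) x₀∼z) xz x≺z)

    no-successor : ∀ {ℓ x z} → R ℓ x ≡ nothing → Reach (R ℓ) x z → ¬ x ≺ z
    no-successor e r x≺z with reach-front r
    ... | inj₁ refl = ≺-irrefl x≺z
    ... | inj₂ (_ , e′ , _) = case trans (sym e) e′ of λ ()

    successor-minimal : ∀ {ℓ x y z} → R ℓ x ≡ just y → Reach (R ℓ) x z → x ≺ z → ¬ z ≺ y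
    successor-minimal e r x≺z z≺y with reach-front r
    ... | inj₁ refl = ≺-irrefl x≺z
    ... | inj₂ (_ , e′ , yz) with trans (sym e) e′ | R-reach-increasing yz
    ...   | refl | inj₁ refl = ≺-irrefl z≺y
    ...   | refl | inj₂ y≺z  = ≺-asym y≺z z≺y

    R-immSucc : ∀ {x₀ x} → Connected x₀ x → ∀ ℓ → ImmSucc (Connected x₀) ℓ x (R ℓ x)
    R-immSucc {x = x} cx ℓ with R ℓ x in e
    ... | nothing = λ z cz xz x≺z → component-reach cx cz xz x≺z λ r → no-successor e r x≺z
    ... | just y  = step cx (viaR ℓ e) , R-prefix e , R-increasing e ,
                    λ z cz xz x≺z z≺y → component-reach cx cz xz x≺z λ r → successor-minimal e r x≺z z≺y

-- Reversing the order

module _ {a ℓ₁ ℓ₂ : Level} {K K′ : StrictTotalOrder a ℓ₁ ℓ₂} {s n : ℕ}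
         {key : Fin n → StrictTotalOrder.Carrier K} {key′ : Fin n → StrictTotalOrder.Carrier K′}
         {m : Fin n → ℕ → Fin s} {R L : ℕ → Fin n → Maybe (Fin n)} where

  private
    module G  = SkipGraph K  key  m R L
    module G′ = SkipGraph K′ key′ m L R

  edge-swap : ∀ {x y} → G.Edge x y → G′.Edge x y
  edge-swap (G.viaR  ℓ e) = G′.viaL  ℓ e
  edge-swap (G.viaL  ℓ e) = G′.viaR  ℓ e
  edge-swap (G.viaR⁻ ℓ e) = G′.viaL⁻ ℓ e
  edge-swap (G.viaL⁻ ℓ e) = G′.viaR⁻ ℓ e

  connected-swap : ∀ {x y} → G.Connected x y → G′.Connected x y
  connected-swap G.here       = G′.here
  connected-swap (G.step c e) = G′.step (connected-swap c) (edge-swap e)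

module _ {a ℓ₁ ℓ₂ : Level} (K : StrictTotalOrder a ℓ₁ ℓ₂) {s n : ℕ}
         (key : Fin n → StrictTotalOrder.Carrier K) (m : Fin n → ℕ → Fin s)
         (R L : ℕ → Fin n → Maybe (Fin n)) where

  private
    Kᵒᵖ : StrictTotalOrder a ℓ₁ ℓ₂
    Kᵒᵖ = Flip.strictTotalOrder K

  open SkipGraph K key m R L
  module Gᵒᵖ = SkipGraph Kᵒᵖ key m L R

  >>=′-agrees : ∀ mx (f : Node → Maybe Node) → (mx >>=′ f) ≡ (mx Maybe.>>= f)
  >>=′-agrees (just x) f = refl
  >>=′-agrees nothing  f = refl

  Rpow-iterate : ∀ ℓ k x → Rpow ℓ k x ≡ iterate (R ℓ) k x
  Rpow-iterate ℓ zero    x = refl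
  Rpow-iterate ℓ (suc k) x rewrite Rpow-iterate ℓ k x = >>=′-agrees (iterate (R ℓ) k x) (R ℓ)

  Lpow-iterate : ∀ ℓ k x → Lpow ℓ k x ≡ iterate (L ℓ) k x
  Lpow-iterate ℓ zero    x = refl
  Lpow-iterate ℓ (suc k) x rewrite Lpow-iterate ℓ k x = >>=′-agrees (iterate (L ℓ) k x) (L ℓ)

  -- With the order reversed, ImmPred and ImmSucc unfold to the same type once the pointer is
  -- known; only the graph in which components are taken changes.
  immPred⇒immSuccᵒᵖ : ∀ {x₀ ℓ x} v → ImmPred (Connected x₀) ℓ x v → Gᵒᵖ.ImmSucc (Gᵒᵖ.Connected x₀) ℓ x v
  immPred⇒immSuccᵒᵖ (just y) (cy , xy , y<x , gap) = connected-swap cy , xy , y<x , λ z → gap z ∘ connected-swap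
  immPred⇒immSuccᵒᵖ nothing  gap                   = λ z → gap z ∘ connected-swap

  immSucc⇒immPredᵒᵖ : ∀ {x₀ ℓ x} v → ImmSucc (Connected x₀) ℓ x v → Gᵒᵖ.ImmPred (Gᵒᵖ.Connected x₀) ℓ x v
  immSucc⇒immPredᵒᵖ (just y) (cy , xy , x<y , gap) = connected-swap cy , xy , x<y , λ z → gap z ∘ connected-swap
  immSucc⇒immPredᵒᵖ nothing  gap                   = λ z → gap z ∘ connected-swap

  immSuccᵒᵖ⇒immPred : ∀ {x₀ ℓ x} v → Gᵒᵖ.ImmSucc (Gᵒᵖ.Connected x₀) ℓ x v → ImmPred (Connected x₀) ℓ x v
  immSuccᵒᵖ⇒immPred (just y) (cy , xy , y<x , gap) = connected-swap cy , xy , y<x , λ z → gap z ∘ connected-swap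
  immSuccᵒᵖ⇒immPred nothing  gap                   = λ z → gap z ∘ connected-swap

  skipGraphsᵒᵖ : AllComponentsSkipGraphs → Gᵒᵖ.AllComponentsSkipGraphs
  skipGraphsᵒᵖ skipGraphs x₀ x c ℓ =
    let (succ , pred) = skipGraphs x₀ x (connected-swap c) ℓ in
    immPred⇒immSuccᵒᵖ (L ℓ x) pred , immSucc⇒immPredᵒᵖ (R ℓ x) succ

  module _ (distinct : DistinctKeys) where

    private
      module Right = RightPointers K key m R L distinct
      module Left  = RightPointers Kᵒᵖ key m L R distinct

    skipGraphs⇒localConstraints : AllComponentsSkipGraphs → LocalConstraints
    skipGraphs⇒localConstraints skipGraphs x ℓ =
      (λ _ → R.R-increasing) , (λ _ → L.R-increasing) ,
      (λ _ → lift ∘ R.R⇒L) , (λ _ → lift ∘ L.R⇒L) ,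
      lift ( Right.FollowsFirstMatch-cong {P = R} (λ ℓ k x → sym (Rpow-iterate ℓ k x)) (R.followsFirstMatch x ℓ)
           , Right.FollowsFirstMatch-cong {P = L} (λ ℓ k x → sym (Lpow-iterate ℓ k x)) (L.followsFirstMatch x ℓ))
      where
      module R = Right.FromSkipGraphs skipGraphs
      module L = Left.FromSkipGraphs (skipGraphsᵒᵖ skipGraphs)

    localConstraints⇒skipGraphs : LocalConstraints → AllComponentsSkipGraphs
    localConstraints⇒skipGraphs constraints x₀ x c ℓ =
      R.R-immSucc c ℓ , immSuccᵒᵖ⇒immPred (L ℓ x) (L.R-immSucc (connected-swap c) ℓ)
      where
      R-increasing : ∀ {ℓ x y} → R ℓ x ≡ just y → Right._≺_ x y
      R-increasing e = proj₁ (constraints _ _) _ e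
      L-increasing : ∀ {ℓ x y} → L ℓ x ≡ just y → Left._≺_ x y
      L-increasing e = proj₁ (proj₂ (constraints _ _)) _ e
      R⇒L : ∀ {ℓ x y} → R ℓ x ≡ just y → L ℓ y ≡ just x
      R⇒L e = lower (proj₁ (proj₂ (proj₂ (constraints _ _))) _ e)
      L⇒R : ∀ {ℓ x y} → L ℓ x ≡ just y → R ℓ y ≡ just x
      L⇒R e = lower (proj₁ (proj₂ (proj₂ (proj₂ (constraints _ _)))) _ e)
      rules : ∀ x ℓ → C5 x ℓ × C6 x ℓ
      rules x ℓ = lower (proj₂ (proj₂ (proj₂ (proj₂ (constraints x ℓ)))))
      module R = Right.FromConstraints R-increasing R⇒L L⇒R
        (λ x ℓ → Right.FollowsFirstMatch-cong {P = R} Rpow-iterate (proj₁ (rules x ℓ)))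
      module L = Left.FromConstraints L-increasing L⇒R R⇒L
        (λ x ℓ → Right.FollowsFirstMatch-cong {P = L} Lpow-iterate (proj₂ (rules x ℓ)))

theorem1 : {a ℓ₁ ℓ₂ : Level} (K : StrictTotalOrder a ℓ₁ ℓ₂) (s n : ℕ)
    (key : Fin n → StrictTotalOrder.Carrier K)
    (m : Fin n → ℕ → Fin s)
    (R L : ℕ → Fin n → Maybe (Fin n)) →
    SkipGraph.DistinctKeys K key m R L →
    (SkipGraph.AllComponentsSkipGraphs K key m R L
    ⇔ SkipGraph.LocalConstraints K key m R L)
theorem1 K s n key m R L distinct =
  mk⇔ (skipGraphs⇒localConstraints K key m R L distinct) (localConstraints⇒skipGraphs K key m R L distinct)
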